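{- Let $n>1$ and $k\ge1$, and let $\mathcal{B}=\{\mathcal{B}^{(0)},\mathcal{B}^{(1)},\mathcal{B}^{(2)}\}$ be a special $n$-Brinkhuis $k$-triple such that some word $w_1^{(0)}\in\mathcal{B}^{(0)}$ starts with the letters $01$. Then $n\ge13$, and either every word in $\mathcal{B}^{(0)}$ starts with $012021$ and ends with $120210$, or every word in $\mathcal{B}^{(0)}$ starts with $012102$ and ends with $201210$.
   Context: Words are over $\{0,1,2\}$; a word is square-free if it cannot be written as $xyyz$ with $y$ nonempty. For a word $w$, $\bar w$ is its reversal. Let $\tau$ be the letter permutation $0\mapsto1,1\mapsto2,2\mapsto0$, applied letterwise to words and elementwise to sets. An $n$-Brinkhuis $(k_0,k_1,k_2)$-triple is a family of sets $\mathcal{B}^{(0)},\mathcal{B}^{(1)},\mathcal{B}^{(2)}$ of square-free words of length $n$, $|\mathcal{B}^{(i)}|=k_i\ge1$, all $k_0+k_1+k_2$ words pairwise distinct, such that for every square-free word $ii'i''$ of length 3 and all $w\in\mathcal{B}^{(i)},w'\in\mathcal{B}^{(i')},w''\in\mathcal{B}^{(i'')}$ the word $ww'w''$ is square-free. A special $n$-Brinkhuis $k$-triple is an $n$-Brinkhuis $(k,k,k)$-triple with $\mathcal{B}^{(2)}=\tau(\mathcal{B}^{(1)})=\tau^2(\mathcal{B}^{(0)})$ and such that $w\in\mathcal{B}^{(0)}$ implies $\bar w\in\mathcal{B}^{(0)}$. -}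

module Defs where

open import Data.Nat using (ℕ; zero; suc; _≥_)
open import Data.Fin using (Fin; zero; suc)
open import Data.List using (List; []; _∷_; _++_; length; map; reverse)
open import Data.List.Membership.Propositional using (_∈_)
open import Data.List.Relation.Unary.Unique.Propositional using (Unique)
open import Data.Product using (_×_)
open import Relation.Binary.PropositionalEquality using (_≡_; _≢_)
open import Function.Bundles using (_⇔_)

Letter : Set
Letter = Fin 3

Word : Set
Word = List Letter

SquareFree : Word → Set
SquareFree w = ∀ (x y z : Word) → y ≢ [] → w ≢ x ++ y ++ y ++ z

τ : Letter → Letter
τ zero = suc zero
τ (suc zero) = suc (suc zero)
τ (suc (suc zero)) = zero

τw : Word → Word
τw = map τ

-- A finite set of words is represented by a duplicate-free list.
-- Sets are equal when they have the same members.
SameSet : List Word → List Word → Set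
SameSet A B = ∀ w → (w ∈ A) ⇔ (w ∈ B)

pick : {A : Set} → A → A → A → Letter → A
pick a b c zero = a
pick a b c (suc zero) = b
pick a b c (suc (suc zero)) = c

record BrinkhuisTriple (n k0 k1 k2 : ℕ) (B0 B1 B2 : List Word) : Set where
  field
    k0≥1 : k0 ≥ 1
    k1≥1 : k1 ≥ 1
    k2≥1 : k2 ≥ 1
    size0 : length B0 ≡ k0
    size1 : length B1 ≡ k1
    size2 : length B2 ≡ k2
    distinct : Unique (B0 ++ B1 ++ B2)
    wordLength : ∀ (i : Letter) (w : Word) → w ∈ pick B0 B1 B2 i → length w ≡ n
    wordSqFree : ∀ (i : Letter) (w : Word) → w ∈ pick B0 B1 B2 i → SquareFree w
    combine : ∀ (i i′ i″ : Letter) → SquareFree (i ∷ i′ ∷ i″ ∷ []) →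
      ∀ (w w′ w″ : Word) → w ∈ pick B0 B1 B2 i → w′ ∈ pick B0 B1 B2 i′ →
      w″ ∈ pick B0 B1 B2 i″ → SquareFree (w ++ w′ ++ w″)

record SpecialBrinkhuisTriple (n k : ℕ) (B0 B1 B2 : List Word) : Set where
  field
    triple : BrinkhuisTriple n k k k B0 B1 B2
    B2≡τB1 : SameSet B2 (map τw B1)
    τB1≡τ²B0 : SameSet (map τw B1) (map τw (map τw B0))
    reverseClosed : ∀ (w : Word) → w ∈ B0 → reverse w ∈ B0

l0 l1 l2 : Letter
l0 = zero
l1 = suc zero
l2 = suc (suc zero)

StartsWith : Word → Word → Set
StartsWith w u = Data.Product.Σ Word (λ v → w ≡ u ++ v)

EndsWith : Word → Word → Set
EndsWith w u = Data.Product.Σ Word (λ v → w ≡ v ++ u)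

{-# OPTIONS --safe #-}
module Submission where

-- Only B⁽⁰⁾ matters. For u, v, w ∈ B⁽⁰⁾ the words u τ(v) w and u τ²(v) w are square-free
-- (they come from 010 and 020), and B⁽⁰⁾ is closed under reversal; hence for u, v ∈ B⁽⁰⁾ the
-- reversed six-letter prefix of u followed by τ or τ² of the six-letter prefix of v is
-- square-free. A finite search on these short words then shows: a word 01… of B⁽⁰⁾ is longer
-- than 5 and its prefix p of length 6 is 012021 or 012102; every word of B⁽⁰⁾ has the prefix p,
-- so by reversal also the suffix (reverse p); and no word w = p r with |r| ≤ 6 and suffix
-- (reverse p) has both w τ(w) w and w τ²(w) w square-free, so n ≥ 13.

open import Defs
open import Data.Nat using (ℕ; zero; suc; s≤s; s≤s⁻¹; _≤_; _<_; _>_; _≥_; _∸_)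
open import Data.Nat.Properties using (≮⇒≥; ∸-monoˡ-≤; m≤n⇒m⊓n≡m; suc-injective)
open import Data.Fin using (_≟_)
import Data.Fin as Fin
open import Data.List using (List; []; _∷_; [_]; _++_; length; reverse; take; drop;
  allFin; upTo; concatMap; cartesianProductWith)
open import Data.List.Properties using (++-assoc; ∷-injectiveʳ; map-++; map-injective;
  take++drop≡id; length-take; length-drop; reverse-++; reverse-involutive; ≡-dec)
open import Data.List.Membership.Propositional using (_∈_)
open import Data.List.Membership.Propositional.Properties
  using (∈-map⁺; ∈-map⁻; ∈-allFin; ∈-upTo⁺; ∈-concatMap⁺; ∈-cartesianProductWith⁺)
open import Data.List.Relation.Unary.All as All using (All; all?)
open import Data.List.Relation.Unary.Any as Any using (here; there)
open import Data.List.Relation.Binary.Prefix.Heterogeneous using (Prefix)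
open import Data.List.Relation.Binary.Prefix.Heterogeneous.Properties using (prefix?)
open import Data.List.Relation.Binary.Prefix.Propositional.Properties
  using (Prefix-as-∣ˡ; ∣ˡ-as-Prefix)
open import Data.Product using (_×_; _,_; ∃₂; ∃-syntax; uncurry)
open import Data.Sum using (_⊎_; inj₁; inj₂)
open import Data.Empty using (⊥-elim)
open import Function using (_∘_)
open import Function.Bundles using (Equivalence)
open import Relation.Nullary using (Dec; yes; no; ¬_; ¬?; _×-dec_; _⊎-dec_; _→-dec_)
open import Relation.Nullary.Decidable using (map′; from-yes)
open import Relation.Unary using (Decidable)
open import Relation.Binary.Definitions using (DecidableEquality)
open import Relation.Binary.PropositionalEquality
  using (_≡_; _≢_; refl; sym; trans; cong; subst; subst₂; module ≡-Reasoning)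

squareFree-[] : SquareFree []
squareFree-[] [] [] _ y≢[] _ = y≢[] refl
squareFree-[] [] (_ ∷ _) _ _ ()
squareFree-[] (_ ∷ _) _ _ _ ()

squareFree-++⁻ˡ : ∀ u v → SquareFree (u ++ v) → SquareFree u
squareFree-++⁻ˡ _ v sf x y z y≢[] refl = sf x y (z ++ v) y≢[] (begin
  (x ++ y ++ y ++ z) ++ v   ≡⟨ ++-assoc x _ v ⟩
  x ++ (y ++ y ++ z) ++ v   ≡⟨ cong (x ++_) (++-assoc y _ v) ⟩
  x ++ y ++ (y ++ z) ++ v   ≡⟨ cong (λ s → x ++ y ++ s) (++-assoc y z v) ⟩
  x ++ y ++ y ++ z ++ v     ∎)
  where open ≡-Reasoning

squareFree-++⁻ʳ : ∀ u v → SquareFree (u ++ v) → SquareFree v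
squareFree-++⁻ʳ u _ sf x y z y≢[] refl = sf (u ++ x) y z y≢[] (sym (++-assoc u x _))

squareFree-middle : ∀ x u v y → SquareFree ((x ++ u) ++ (v ++ y)) → SquareFree (u ++ v)
squareFree-middle x u v y sf = squareFree-++⁻ˡ (u ++ v) y (squareFree-++⁻ʳ x ((u ++ v) ++ y)
  (subst SquareFree (trans (++-assoc x u (v ++ y)) (cong (x ++_) (sym (++-assoc u v y)))) sf))

SquarePrefixed : Word → Set
SquarePrefixed w = ∃₂ λ y r → y ≢ [] × w ≡ y ++ r × Prefix _≡_ y r

squareFree-∷⁺ : ∀ {a w} → SquareFree w → ¬ SquarePrefixed (a ∷ w) → SquareFree (a ∷ w)
squareFree-∷⁺ _  ¬sp []      y z y≢[] eq =
  ¬sp (y , y ++ z , y≢[] , eq , ∣ˡ-as-Prefix record { quotient = z ; equality = refl })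
squareFree-∷⁺ sf _   (_ ∷ x) y z y≢[] eq = sf x y z y≢[] (∷-injectiveʳ eq)

squareFree-∷⁻ : ∀ {a w} → SquareFree (a ∷ w) → SquareFree w × ¬ SquarePrefixed (a ∷ w)
squareFree-∷⁻ {a} {w} sf = squareFree-++⁻ʳ [ a ] w sf , square
  where
  square : ¬ SquarePrefixed (a ∷ w)
  square (y , r , y≢[] , eq , y⊑r)
    with record { quotient = z ; equality = refl } ← Prefix-as-∣ˡ y⊑r = sf [] y z y≢[] eq

∃-nonemptyPrefix? : {P : Word → Word → Set} → (∀ y r → Dec (P y r)) →
                    ∀ w → Dec (∃₂ λ y r → y ≢ [] × w ≡ y ++ r × P y r)
∃-nonemptyPrefix? P? [] = no λ { ([] , _ , y≢[] , _) → y≢[] refl ; (_ ∷ _ , _ , _ , () , _) }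
∃-nonemptyPrefix? {P} P? (a ∷ w) =
  map′ grow shrink (P? [ a ] w ⊎-dec ∃-nonemptyPrefix? (P? ∘ (a ∷_)) w)
  where
  grow : P [ a ] w ⊎ (∃₂ λ y r → y ≢ [] × w ≡ y ++ r × P (a ∷ y) r) →
         ∃₂ λ y r → y ≢ [] × a ∷ w ≡ y ++ r × P y r
  grow (inj₁ p) = [ a ] , w , (λ ()) , refl , p
  grow (inj₂ (y , r , _ , refl , p)) = a ∷ y , r , (λ ()) , refl , p
  shrink : (∃₂ λ y r → y ≢ [] × a ∷ w ≡ y ++ r × P y r) →
           P [ a ] w ⊎ ∃₂ λ y r → y ≢ [] × w ≡ y ++ r × P (a ∷ y) r
  shrink ([] , _ , y≢[] , _) = ⊥-elim (y≢[] refl)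
  shrink (_ ∷ [] , _ , _ , refl , p) = inj₁ p
  shrink (_ ∷ b ∷ y , r , _ , refl , p) = inj₂ (b ∷ y , r , (λ ()) , refl , p)

squareFree? : Decidable SquareFree
squareFree? [] = yes squareFree-[]
squareFree? (a ∷ w) = map′ (uncurry squareFree-∷⁺) squareFree-∷⁻
  (squareFree? w ×-dec ¬? (∃-nonemptyPrefix? (prefix? _≟_) (a ∷ w)))

_≟w_ : DecidableEquality Word
_≟w_ = ≡-dec _≟_

open import Data.List.Membership.DecPropositional _≟w_ using (_∈?_)

words : ℕ → List Word
words zero    = [ [] ]
words (suc k) = cartesianProductWith _∷_ (allFin 3) (words k)

∈-words : ∀ w → w ∈ words (length w)
∈-words []      = here refl
∈-words (a ∷ w) = ∈-cartesianProductWith⁺ _∷_ (∈-allFin a) (∈-words w)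

words≤ : ℕ → List Word
words≤ k = concatMap words (upTo (suc k))

∈-words≤ : ∀ {k} w → length w ≤ k → w ∈ words≤ k
∈-words≤ w |w|≤k = ∈-concatMap⁺ words (Any.map (λ { refl → ∈-words w }) (∈-upTo⁺ (s≤s |w|≤k)))

module _ {P : Word → Set} where

  all-words : ∀ k → All P (words k) → ∀ w → length w ≡ k → P w
  all-words _ all-P w refl = All.lookup all-P (∈-words w)

  all-words≤ : ∀ k → All P (words≤ k) → ∀ w → length w ≤ k → P w
  all-words≤ _ all-P w |w|≤k = All.lookup all-P (∈-words≤ w |w|≤k)

τ²w : Word → Word
τ²w = τw ∘ τw

Joinable : Word → Word → Set
Joinable u v = SquareFree (u ++ τw v) × SquareFree (u ++ τ²w v)

SandwichFree : Word → Set
SandwichFree u = SquareFree (u ++ τw u ++ u) × SquareFree (u ++ τ²w u ++ u)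

joinable? : ∀ u v → Dec (Joinable u v)
joinable? u v = squareFree? (u ++ τw v) ×-dec squareFree? (u ++ τ²w v)

sandwichFree? : Decidable SandwichFree
sandwichFree? u = squareFree? (u ++ τw u ++ u) ×-dec squareFree? (u ++ τ²w u ++ u)

τw-++ : ∀ u v → τw (u ++ v) ≡ τw u ++ τw v
τw-++ = map-++ τ

τ²w-++ : ∀ u v → τ²w (u ++ v) ≡ τ²w u ++ τ²w v
τ²w-++ u v = trans (cong τw (τw-++ u v)) (τw-++ (τw u) (τw v))

τ³≡id : ∀ a → τ (τ (τ a)) ≡ a
τ³≡id Fin.zero                     = refl
τ³≡id (Fin.suc Fin.zero)           = refl
τ³≡id (Fin.suc (Fin.suc Fin.zero)) = refl

τ-injective : ∀ {a b} → τ a ≡ τ b → a ≡ b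
τ-injective {a} {b} eq = trans (sym (τ³≡id a)) (trans (cong (τ ∘ τ) eq) (τ³≡id b))

joinable-infix : ∀ x u v y → Joinable (x ++ u) (v ++ y) → Joinable u v
joinable-infix x u v y (sf , sf²) =
  squareFree-middle x u (τw v) (τw y) (subst (λ s → SquareFree ((x ++ u) ++ s)) (τw-++ v y) sf) ,
  squareFree-middle x u (τ²w v) (τ²w y) (subst (λ s → SquareFree ((x ++ u) ++ s)) (τ²w-++ v y) sf²)

head₁ head₂ : Word
head₁ = l0 ∷ l1 ∷ l2 ∷ l0 ∷ l2 ∷ l1 ∷ []
head₂ = l0 ∷ l1 ∷ l2 ∷ l1 ∷ l0 ∷ l2 ∷ []

heads : List Word
heads = head₁ ∷ head₂ ∷ []

01-short-not-sandwichFree : ∀ t → length t ≤ 3 →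
                            Joinable (reverse (l0 ∷ l1 ∷ t)) (l0 ∷ l1 ∷ t) → ¬ SandwichFree (l0 ∷ l1 ∷ t)
01-short-not-sandwichFree = all-words≤ 3 (from-yes (all? (λ t →
  joinable? (reverse (l0 ∷ l1 ∷ t)) (l0 ∷ l1 ∷ t) →-dec ¬? (sandwichFree? (l0 ∷ l1 ∷ t))) (words≤ 3)))

01-head∈heads : ∀ t → length t ≡ 4 →
                Joinable (reverse (l0 ∷ l1 ∷ t)) (l0 ∷ l1 ∷ t) → l0 ∷ l1 ∷ t ∈ heads
01-head∈heads = all-words 4 (from-yes (all? (λ t →
  joinable? (reverse (l0 ∷ l1 ∷ t)) (l0 ∷ l1 ∷ t) →-dec (l0 ∷ l1 ∷ t) ∈? heads) (words 4)))

heads-rigid : ∀ {p} → p ∈ heads → ∀ q → length q ≡ 6 →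
              Joinable (reverse p) q → Joinable (reverse q) p → q ≡ p
heads-rigid p∈heads = all-words 6 (All.lookup (from-yes (all? (λ p → all? (λ q →
  joinable? (reverse p) q →-dec joinable? (reverse q) p →-dec q ≟w p) (words 6)) heads)) p∈heads)

head-short-not-sandwichFree : ∀ {p} → p ∈ heads → ∀ r → length r ≤ 6 →
                              take 6 (reverse (p ++ r)) ≡ p → ¬ SandwichFree (p ++ r)
head-short-not-sandwichFree p∈heads = all-words≤ 6 (All.lookup (from-yes (all? (λ p → all? (λ r →
  take 6 (reverse (p ++ r)) ≟w p →-dec ¬? (sandwichFree? (p ++ r))) (words≤ 6)) heads)) p∈heads)

-- What the proof uses of B⁽⁰⁾ in a special triple; the sandwiches come from the words 010 and 020.
record Admissible (n : ℕ) (S : List Word) : Set where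
  field
    length-≡    : ∀ {u} → u ∈ S → length u ≡ n
    reverse-∈   : ∀ {u} → u ∈ S → reverse u ∈ S
    τ-sandwich  : ∀ {u v w} → u ∈ S → v ∈ S → w ∈ S → SquareFree (u ++ τw v ++ w)
    τ²-sandwich : ∀ {u v w} → u ∈ S → v ∈ S → w ∈ S → SquareFree (u ++ τ²w v ++ w)

special⇒admissible : ∀ {n k B0 B1 B2} → SpecialBrinkhuisTriple n k B0 B1 B2 → Admissible n B0
special⇒admissible {B0 = B0} {B1} {B2} special = record
  { length-≡    = wordLength l0 _
  ; reverse-∈   = reverseClosed _
  ; τ-sandwich  = λ u∈ v∈ w∈ → combine l0 l1 l0 (from-yes (squareFree? (l0 ∷ l1 ∷ l0 ∷ [])))
                                 _ _ _ u∈ (τ-∈ v∈) w∈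
  ; τ²-sandwich = λ u∈ v∈ w∈ → combine l0 l2 l0 (from-yes (squareFree? (l0 ∷ l2 ∷ l0 ∷ [])))
                                 _ _ _ u∈ (τ²-∈ v∈) w∈
  }
  where
  open SpecialBrinkhuisTriple special
  open BrinkhuisTriple triple

  τ-∈ : ∀ {v} → v ∈ B0 → τw v ∈ B1
  τ-∈ v∈ with x , x∈ , eq ← ∈-map⁻ τw (Equivalence.from (τB1≡τ²B0 _) (∈-map⁺ τw (∈-map⁺ τw v∈)))
    = subst (_∈ B1) (sym (map-injective τ-injective eq)) x∈

  τ²-∈ : ∀ {v} → v ∈ B0 → τ²w v ∈ B2
  τ²-∈ v∈ = Equivalence.from (B2≡τB1 _) (∈-map⁺ τw (τ-∈ v∈))

take-startsWith : ∀ k {u p : Word} → take k u ≡ p → StartsWith u p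
take-startsWith k {u} refl = drop k u , sym (take++drop≡id k u)

reverse-take : ∀ k (u : Word) → reverse u ≡ reverse (drop k u) ++ reverse (take k u)
reverse-take k u = trans (cong reverse (sym (take++drop≡id k u))) (reverse-++ (take k u) (drop k u))

take-reverse-endsWith : ∀ k {u p : Word} → take k (reverse u) ≡ p → EndsWith u (reverse p)
take-reverse-endsWith k {u} refl = reverse (drop k (reverse u)) ,
  trans (sym (reverse-involutive u)) (reverse-take k (reverse u))

module Admissible-properties {n S} (adm : Admissible n S) where
  open Admissible adm

  joinable-reverse : ∀ {u v} → u ∈ S → v ∈ S → Joinable (reverse u) v
  joinable-reverse {u} {v} u∈ v∈ =
    drop-last (τ-sandwich (reverse-∈ u∈) v∈ v∈) , drop-last (τ²-sandwich (reverse-∈ u∈) v∈ v∈)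
    where
    drop-last : ∀ {x} → SquareFree (reverse u ++ x ++ v) → SquareFree (reverse u ++ x)
    drop-last {x} = squareFree-++⁻ˡ (reverse u ++ x) v ∘ subst SquareFree (sym (++-assoc (reverse u) x v))

  sandwichFree : ∀ {u} → u ∈ S → SandwichFree u
  sandwichFree u∈ = τ-sandwich u∈ u∈ u∈ , τ²-sandwich u∈ u∈ u∈

  module _ (n≥6 : n ≥ 6) where

    length-take6 : ∀ {u} → u ∈ S → length (take 6 u) ≡ 6
    length-take6 {u} u∈ = trans (length-take 6 u) (m≤n⇒m⊓n≡m (subst (6 ≤_) (sym (length-≡ u∈)) n≥6))

    joinable-heads : ∀ {u v} → u ∈ S → v ∈ S → Joinable (reverse (take 6 u)) (take 6 v)
    joinable-heads {u} {v} u∈ v∈ = joinable-infix (reverse (drop 6 u)) _ _ (drop 6 v)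
      (subst₂ Joinable (reverse-take 6 u) (sym (take++drop≡id 6 v)) (joinable-reverse u∈ v∈))

  module _ {t} (01t∈S : l0 ∷ l1 ∷ t ∈ S) where

    n≥6 : n ≥ 6
    n≥6 = ≮⇒≥ λ n<6 → 01-short-not-sandwichFree t
      (s≤s⁻¹ (s≤s⁻¹ (s≤s⁻¹ (subst (_< 6) (sym (length-≡ 01t∈S)) n<6))))
      (joinable-reverse 01t∈S 01t∈S) (sandwichFree 01t∈S)

    p : Word
    p = take 6 (l0 ∷ l1 ∷ t)

    p∈heads : p ∈ heads
    p∈heads = 01-head∈heads (take 4 t)
      (suc-injective (suc-injective (length-take6 n≥6 01t∈S))) (joinable-heads n≥6 01t∈S 01t∈S)

    take6≡p : ∀ {v} → v ∈ S → take 6 v ≡ p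
    take6≡p v∈ = heads-rigid p∈heads _ (length-take6 n≥6 v∈)
                   (joinable-heads n≥6 01t∈S v∈) (joinable-heads n≥6 v∈ 01t∈S)

    n≥13 : n ≥ 13
    n≥13 = ≮⇒≥ λ n<13 → head-short-not-sandwichFree p∈heads r (|r|≤6 n<13)
      (subst (λ w → take 6 (reverse w) ≡ p) 01t≡pr (take6≡p (reverse-∈ 01t∈S)))
      (subst SandwichFree 01t≡pr (sandwichFree 01t∈S))
      where
      r : Word
      r = drop 6 (l0 ∷ l1 ∷ t)

      01t≡pr : l0 ∷ l1 ∷ t ≡ p ++ r
      01t≡pr = sym (take++drop≡id 6 (l0 ∷ l1 ∷ t))

      |r|≤6 : n < 13 → length r ≤ 6
      |r|≤6 n<13 = subst (_≤ 6)
        (sym (trans (length-drop 6 (l0 ∷ l1 ∷ t)) (cong (_∸ 6) (length-≡ 01t∈S))))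
        (∸-monoˡ-≤ 6 (s≤s⁻¹ n<13))

    shape : ∀ {h} → p ≡ h → ∀ w → w ∈ S → StartsWith w h × EndsWith w (reverse h)
    shape refl w w∈ =
      take-startsWith 6 (take6≡p w∈) , take-reverse-endsWith 6 (take6≡p (reverse-∈ w∈))

    shapes : (∀ w → w ∈ S → StartsWith w head₁ × EndsWith w (reverse head₁))
           ⊎ (∀ w → w ∈ S → StartsWith w head₂ × EndsWith w (reverse head₂))
    shapes with p∈heads
    ... | here p≡head₁         = inj₁ (shape p≡head₁)
    ... | there (here p≡head₂) = inj₂ (shape p≡head₂)

proposition1 : ∀ (n k : ℕ) (B0 B1 B2 : List Word) → n > 1 → k ≥ 1 →
    SpecialBrinkhuisTriple n k B0 B1 B2 →
    (∃[ w ] (w ∈ B0 × StartsWith w (l0 ∷ l1 ∷ []))) →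
    n ≥ 13 ×
    ((∀ w → w ∈ B0 →
        StartsWith w (l0 ∷ l1 ∷ l2 ∷ l0 ∷ l2 ∷ l1 ∷ [])
        × EndsWith w (l1 ∷ l2 ∷ l0 ∷ l2 ∷ l1 ∷ l0 ∷ []))
     ⊎ (∀ w → w ∈ B0 →
        StartsWith w (l0 ∷ l1 ∷ l2 ∷ l1 ∷ l0 ∷ l2 ∷ [])
        × EndsWith w (l2 ∷ l0 ∷ l1 ∷ l2 ∷ l1 ∷ l0 ∷ [])))
proposition1 n k B0 B1 B2 _ _ special (_ , 01t∈B0 , _ , refl) = n≥13 01t∈B0 , shapes 01t∈B0
  where open Admissible-properties (special⇒admissible special)
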